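{- Let $(U,\varphi)$ be a finite standard closure space whose lattice of closed sets is modular, let $C$ be a non-join-irreducible essential set with predecessors $C_1,\dots,C_m$, and $C_*=C_1\cap\dots\cap C_m$. Then a pseudo-closed set of the form $P=C_i\cup C_j$ with $\varphi(P)=C$ is faulty if and only if there exists a predecessor $C_k\notin\{C_i,C_j\}$ of $C$ with $|C_k\setminus C_*|>1$.
   Context: $(U,\varphi)$: finite set with closure operator; closed sets form a lattice under inclusion; standard: $\varphi(\{x\})\setminus\{x\}$ closed for all $x$. Predecessor of $C$: closed $C'\subsetneq C$ with no closed set strictly between; join-irreducible: exactly one predecessor. Quasi-closed $Q$: for all $X\subseteq Q$ with $\varphi(X)\subsetneq\varphi(Q)$, $\varphi(X)\subseteq Q$; pseudo-closed $P$: not closed and inclusion-minimal among quasi-closed $Q$ with $\varphi(Q)=\varphi(P)$; essential: $\varphi(P)$ for $P$ pseudo-closed. $\varphi^b(X)=\bigcup_{y\in X}\varphi(\{y\})$. $D$-generator of $x$: $A$ with $x\in\varphi(A)$, $x\notin\varphi^b(A)$, and $x\notin\varphi(B)$ whenever $\varphi^b(B)\subsetneq\varphi^b(A)$; $E$-generator: a $D$-generator $A$ with $\varphi(A)$ inclusion-minimal among closures of $D$-generators of $x$. $E$-base $\Sigma_E=\{a\to x: x\neq a,x\in\varphi(\{a\})\}\cup\{A\to x: A \text{ an } E\text{ -generator of } x\}$ with induced closure operator $\Sigma_E(\cdot)$. A pseudo-closed set $P$ is faulty if $\varphi(P)\not\subseteq\Sigma_E(P)$, i.e. the implication $P\to\varphi(P)\setminus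 P$ does not follow from the $E$-base. -}

module Defs where

open import Data.Nat using (ℕ; _<_)
open import Data.Fin using (Fin)
open import Data.Fin.Subset using (Subset; ⁅_⁆; _∈_; _∉_; _⊆_; _⊂_; _∩_; _∪_; _─_; ⋃; ⊤; ⊥; ∣_∣)
open import Data.Fin.Subset.Properties using (_∈?_)
open import Data.List using (List; map; foldr; allFin)
open import Data.List.Membership.Propositional using () renaming (_∈_ to _∈ₗ_)
open import Data.Bool using (if_then_else_)
open import Data.Product using (Σ; ∃; ∃-syntax; _×_)
open import Data.Sum using (_⊎_)
open import Relation.Nullary using (¬_; does)
open import Relation.Binary.PropositionalEquality using (_≡_; _≢_)
open import Function.Bundles using (_⇔_)

record ClosureOperator (n : ℕ) : Set where
  field
    φ          : Subset n → Subset n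
    extensive  : ∀ X → X ⊆ φ X
    monotone   : ∀ {X Y} → X ⊆ Y → φ X ⊆ φ Y
    idempotent : ∀ X → φ (φ X) ≡ φ X

module _ {n : ℕ} (cl : ClosureOperator n) where
  open ClosureOperator cl

  Closed : Subset n → Set
  Closed X = φ X ≡ X

  Standard : Set
  Standard = ∀ x → Closed (φ ⁅ x ⁆ ─ ⁅ x ⁆)

  -- the lattice of closed sets (meet = ∩, join X ∨ Y = φ (X ∪ Y)) is modular
  Modular : Set
  Modular = ∀ A B C → Closed A → Closed B → Closed C → A ⊆ C →
            φ (A ∪ (B ∩ C)) ≡ φ (A ∪ B) ∩ C

  Predecessor : Subset n → Subset n → Set
  Predecessor C' C = Closed C' × C' ⊂ C ×
    (∀ D → Closed D → C' ⊂ D → D ⊂ C → ⊥')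
    where open import Data.Empty renaming (⊥ to ⊥')

  JoinIrreducible : Subset n → Set
  JoinIrreducible C = ∃[ D ] (Predecessor D C × (∀ D' → Predecessor D' C → D' ≡ D))

  QuasiClosed : Subset n → Set
  QuasiClosed Q = ∀ X → X ⊆ Q → φ X ⊂ φ Q → φ X ⊆ Q

  PseudoClosed : Subset n → Set
  PseudoClosed P = ¬ Closed P × QuasiClosed P ×
    (∀ Q → QuasiClosed Q → φ Q ≡ φ P → Q ⊆ P → Q ≡ P)

  Essential : Subset n → Set
  Essential C = ∃[ P ] (PseudoClosed P × φ P ≡ C)

  φᵇ : Subset n → Subset n
  φᵇ X = ⋃ (map (λ y → if does (y ∈? X) then φ ⁅ y ⁆ else ⊥) (allFin n))

  DGenerator : Subset n → Fin n → Set
  DGenerator A x = x ∈ φ A × x ∉ φᵇ A × (∀ B → φᵇ B ⊂ φᵇ A → x ∉ φ B)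

  EGenerator : Subset n → Fin n → Set
  EGenerator A x = DGenerator A x × (∀ A' → DGenerator A' x → ¬ (φ A' ⊂ φ A))

  -- implications A → x of the E-base
  EBase : Subset n → Fin n → Set
  EBase A x = (∃[ a ] (A ≡ ⁅ a ⁆ × x ≢ a × x ∈ φ ⁅ a ⁆)) ⊎ EGenerator A x

  data InΣE (X : Subset n) : Fin n → Set where
    base : ∀ {x} → x ∈ X → InΣE X x
    step : ∀ {A x} → EBase A x → (∀ y → y ∈ A → InΣE X y) → InΣE X x

  Faulty : Subset n → Set
  Faulty P = ¬ (∀ x → x ∈ φ P → InΣE P x)

  ⋂ : List (Subset n) → Subset n
  ⋂ = foldr _∩_ ⊤

{-# OPTIONS --safe #-}
-- Write P = Ci ∪ Cj and D = Ci ∩ Cj. The modular law, with quasi-closedness of P and the fact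
-- that every point of the non-join-irreducible C lies in a predecessor, makes every predecessor
-- of C contain D; hence C_* = D, and every other predecessor Ck meets P exactly in D.
-- If such a Ck has two points outside D, the E-base never derives a point y ∈ Ck ∖ P from P.
-- Implications a → y stay inside Ci by standardness. For an E-generator A of y, either
-- C ⊆ φ(A), and then D ∪ {z}, for a second point z of Ck ∖ D, generates y with the smaller
-- closure Ck; or φ(A) ⊂ C, which forces φ(A) ⊆ Ck and then A ⊆ Ck ∩ P = D, so y ∈ D.
-- Conversely, if every other predecessor has at most one point outside D, a D-generator A of
-- x ∈ C ∖ P with φᵇ(A) ⊆ P is an E-generator: a D-generator A' with smaller closure lies in
-- a predecessor through x other than Ci and Cj, so A' ⊆ D and x ∈ φ(A') ⊆ D ⊆ P.
module Submission where

open import Defs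
open import Data.Nat using (ℕ; _<_; _≤_; z≤n; _<?_)
open import Data.Nat.Properties using (<⇒≱; module ≤-Reasoning)
open import Data.Fin using (Fin; zero; suc; _≟_)
open import Data.Fin.Properties using (¬∀⟶∃¬)
open import Data.Fin.Subset
  using (Subset; _∈_; _∉_; _⊆_; _⊈_; _⊂_; _⊃_; _∩_; _∪_; _─_; _-_; ⁅_⁆; ⋃; ∣_∣; Nonempty; inside; outside)
  renaming (⊥ to ∅)
open import Data.Fin.Subset.Properties
  using (_∈?_; _⊆?_; _⊂?_; ⊆-refl; ⊆-antisym; ⊆-trans; ⊆-⊂-trans; ⊂-⊆-trans; ∩-comm; p∩q⊆p; p∩q⊆q;
         p⊆p∪q; q⊆p∪q; x∈p∩q⁺; x∈p∩q⁻; x∈p∪q⁺; x∈p∪q⁻; x∈⁅x⁆; x∈⁅y⁆⇒x≡y; x∉⁅y⁆⇒x≢y; ∣⁅x⁆∣≡1;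
         ∉⊥; ∈⊤; x∈p∧x∉q⇒x∈p─q; x∈p∧x≢y⇒x∈p-y; p─q⊆p; p⊆q⇒∣p∣≤∣q∣; x∈p⇒∣p-x∣<∣p∣;
         nonempty?; Empty-unique; ∣⊥∣≡0; anySubset?)
open import Data.Fin.Subset.Induction using (⊂-wellFounded; ⊃-wellFounded)
open import Data.List using (List; []; _∷_; map; allFin)
open import Data.List.Membership.Propositional using (find; lose) renaming (_∈_ to _∈ₗ_)
open import Data.List.Membership.Propositional.Properties using (∈-map⁺; ∈-map⁻; ∈-allFin)
open import Data.List.Relation.Unary.Any using (here; there; any?)
open import Data.Vec using (_∷_; there)
open import Data.Vec.Properties using (≡-dec)
open import Data.Bool using (if_then_else_)
import Data.Bool.Properties as Bool
open import Data.Product using (∃; ∃-syntax; _×_; _,_; proj₁; proj₂)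
open import Data.Sum using (inj₁; inj₂; [_,_]′)
open import Data.Empty using (⊥-elim)
open import Function using (_∘_; const; _on_)
open import Function.Bundles using (_⇔_; mk⇔; Equivalence)
open import Induction.WellFounded using (WfRec; module All)
import Relation.Binary.Construct.On as On
open import Relation.Nullary using (¬_; Dec; yes; no; does)
open import Relation.Nullary.Decidable using (decidable-stable; map′; ¬?; _×-dec_; _→-dec_)
open import Relation.Unary using (Decidable)
open import Relation.Binary.PropositionalEquality using (_≡_; _≢_; refl; sym; trans; cong; subst)

x∈p─q⇒x∉q : ∀ {n} {p q : Subset n} {x} → x ∈ p ─ q → x ∉ q
x∈p─q⇒x∉q {p = _ ∷ _} {inside  ∷ _} {zero}  ()        _
x∈p─q⇒x∉q {p = _ ∷ _} {outside ∷ _} {zero}  _         ()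
x∈p─q⇒x∉q {p = _ ∷ _} {_ ∷ _}       {suc _} (there h) (there k) = x∈p─q⇒x∉q h k

module _ {n : ℕ} where

  private variable
    p q r : Subset n
    x y : Fin n

  ∈-stable : ¬ ¬ x ∈ p → x ∈ p
  ∈-stable = decidable-stable (_ ∈? _)

  ⊈⇒∃∉ : p ⊈ q → ∃ λ x → x ∈ p × x ∉ q
  ⊈⇒∃∉ {p} {q} p⊈q with ¬∀⟶∃¬ n (λ x → x ∈ p → x ∈ q) (λ x → x ∈? p →-dec x ∈? q) (λ p⊆q → p⊈q (p⊆q _))
  ... | x , x∈p↛x∈q = x , ∈-stable (λ x∉p → x∈p↛x∈q (⊥-elim ∘ x∉p)) , x∈p↛x∈q ∘ const

  x∈p⇒⁅x⁆⊆p : x ∈ p → ⁅ x ⁆ ⊆ p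
  x∈p⇒⁅x⁆⊆p {x} {p} x∈p y∈⁅x⁆ = subst (_∈ p) (sym (x∈⁅y⁆⇒x≡y x y∈⁅x⁆)) x∈p

  ∪-least : p ⊆ r → q ⊆ r → p ∪ q ⊆ r
  ∪-least {p = p} {q = q} p⊆r q⊆r x∈p∪q = [ p⊆r , q⊆r ]′ (x∈p∪q⁻ p q x∈p∪q)

  ∈⋃⁺ : ∀ {ps : List (Subset n)} → p ∈ₗ ps → x ∈ p → x ∈ ⋃ ps
  ∈⋃⁺ (here refl)  x∈p = x∈p∪q⁺ (inj₁ x∈p)
  ∈⋃⁺ (there p∈ps) x∈p = x∈p∪q⁺ (inj₂ (∈⋃⁺ p∈ps x∈p))

  ∈⋃⁻ : ∀ (ps : List (Subset n)) → x ∈ ⋃ ps → ∃ λ p → p ∈ₗ ps × x ∈ p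
  ∈⋃⁻ []       x∈⋃ = ⊥-elim (∉⊥ x∈⋃)
  ∈⋃⁻ (p ∷ ps) x∈⋃ with x∈p∪q⁻ p (⋃ ps) x∈⋃
  ... | inj₁ x∈p = p , here refl , x∈p
  ... | inj₂ x∈⋃ps with ∈⋃⁻ ps x∈⋃ps
  ...   | q , q∈ps , x∈q = q , there q∈ps , x∈q

  1<∣p∣⇒Nonempty : 1 < ∣ p ∣ → Nonempty p
  1<∣p∣⇒Nonempty {p} 1<∣p∣ with nonempty? p
  ... | yes ne   = ne
  ... | no empty = ⊥-elim (<⇒≱ 1<∣p∣ (subst (_≤ 1) (sym ∣p∣≡0) z≤n))
    where
      ∣p∣≡0 : ∣ p ∣ ≡ 0
      ∣p∣≡0 = trans (cong ∣_∣ (Empty-unique empty)) (∣⊥∣≡0 n)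

  1<∣p∣⇒∃≢ : 1 < ∣ p ∣ → ∀ y → ∃ λ x → x ∈ p × x ≢ y
  1<∣p∣⇒∃≢ {p} 1<∣p∣ y with nonempty? (p - y)
  ... | yes (x , x∈p-y) = x , p─q⊆p p ⁅ y ⁆ x∈p-y , x∉⁅y⁆⇒x≢y (x∈p─q⇒x∉q x∈p-y)
  ... | no p-y-empty    = ⊥-elim (<⇒≱ 1<∣p∣ ∣p∣≤1)
    where
      open ≤-Reasoning
      p⊆⁅y⁆ : p ⊆ ⁅ y ⁆
      p⊆⁅y⁆ x∈p = ∈-stable (λ x∉⁅y⁆ → p-y-empty (_ , x∈p∧x∉q⇒x∈p─q x∈p x∉⁅y⁆))
      ∣p∣≤1 : ∣ p ∣ ≤ 1
      ∣p∣≤1 = begin ∣ p ∣ ≤⟨ p⊆q⇒∣p∣≤∣q∣ p⊆⁅y⁆ ⟩ ∣ ⁅ y ⁆ ∣ ≡⟨ ∣⁅x⁆∣≡1 y ⟩ 1 ∎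

  x∈p∧y∈p∧x≢y⇒1<∣p∣ : x ∈ p → y ∈ p → x ≢ y → 1 < ∣ p ∣
  x∈p∧y∈p∧x≢y⇒1<∣p∣ {x} {p} {y} x∈p y∈p x≢y = begin-strict
    1           ≡⟨ sym (∣⁅x⁆∣≡1 y) ⟩
    ∣ ⁅ y ⁆ ∣   ≤⟨ p⊆q⇒∣p∣≤∣q∣ (x∈p⇒⁅x⁆⊆p (x∈p∧x≢y⇒x∈p-y y∈p (x≢y ∘ sym))) ⟩
    ∣ p - x ∣   <⟨ x∈p⇒∣p-x∣<∣p∣ x∈p ⟩
    ∣ p ∣       ∎
    where open ≤-Reasoning

∃-listed? : ∀ {a} {A : Set a} {Q R : A → Set} (xs : List A) →
            (∀ y → (y ∈ₗ xs) ⇔ Q y) → Decidable R → Dec (∃ λ y → Q y × R y)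
∃-listed? xs listed R? = map′
  (λ any → let y , y∈xs , Ry = find any in y , Equivalence.to (listed y) y∈xs , Ry)
  (λ (y , Qy , Ry) → lose (Equivalence.from (listed y) Qy) Ry)
  (any? R? xs)

module ClosureProperties {n : ℕ} (cl : ClosureOperator n) where
  open ClosureOperator cl

  private variable
    A B C F X Y Z : Subset n
    x : Fin n

  φ-least : X ⊆ Y → Closed cl Y → φ X ⊆ Y
  φ-least X⊆Y φY≡Y = subst (_ ∈_) φY≡Y ∘ monotone X⊆Y

  φ⊆⇒Closed : φ X ⊆ X → Closed cl X
  φ⊆⇒Closed {X} φX⊆X = ⊆-antisym φX⊆X (extensive X)

  Closed? : ∀ X → Dec (Closed cl X)
  Closed? X = ≡-dec Bool._≟_ (φ X) X

  Closed-∩ : Closed cl X → Closed cl Y → Closed cl (X ∩ Y)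
  Closed-∩ {X} {Y} cX cY =
    φ⊆⇒Closed (λ h → x∈p∩q⁺ (φ-least (p∩q⊆p X Y) cX h , φ-least (p∩q⊆q X Y) cY h))

  ∈⋂⁺ : ∀ {Xs} → (∀ {X} → X ∈ₗ Xs → x ∈ X) → x ∈ ⋂ cl Xs
  ∈⋂⁺ {Xs = []}     _     = ∈⊤
  ∈⋂⁺ {Xs = X ∷ Xs} x∈all = x∈p∩q⁺ (x∈all (here refl) , ∈⋂⁺ (x∈all ∘ there))

  ∈⋂⁻ : ∀ {Xs} → x ∈ ⋂ cl Xs → X ∈ₗ Xs → x ∈ X
  ∈⋂⁻ {Xs = X ∷ Xs} x∈⋂ (here refl) = proj₁ (x∈p∩q⁻ X (⋂ cl Xs) x∈⋂)
  ∈⋂⁻ {Xs = X ∷ Xs} x∈⋂ (there m)   = ∈⋂⁻ (proj₂ (x∈p∩q⁻ X (⋂ cl Xs) x∈⋂)) m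

  private
    φᵇ-summand : Subset n → Fin n → Subset n
    φᵇ-summand X y = if does (y ∈? X) then φ ⁅ y ⁆ else ∅

    ∈φᵇ-summand⁻ : ∀ X y → x ∈ φᵇ-summand X y → y ∈ X × x ∈ φ ⁅ y ⁆
    ∈φᵇ-summand⁻ X y h with y ∈? X
    ... | yes y∈X = y∈X , h
    ... | no _    = ⊥-elim (∉⊥ h)

    ∈φᵇ-summand⁺ : ∀ X y → y ∈ X → x ∈ φ ⁅ y ⁆ → x ∈ φᵇ-summand X y
    ∈φᵇ-summand⁺ X y y∈X h with y ∈? X
    ... | yes _  = h
    ... | no y∉X = ⊥-elim (y∉X y∈X)

  ∈φᵇ⁻ : ∀ X → x ∈ φᵇ cl X → ∃ λ y → y ∈ X × x ∈ φ ⁅ y ⁆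
  ∈φᵇ⁻ X h with ∈⋃⁻ (map (φᵇ-summand X) (allFin n)) h
  ... | S , S∈summands , x∈S with ∈-map⁻ (φᵇ-summand X) S∈summands
  ...   | y , _ , refl = y , ∈φᵇ-summand⁻ X y x∈S

  ⊆φᵇ : X ⊆ φᵇ cl X
  ⊆φᵇ {X} {x} x∈X =
    ∈⋃⁺ (∈-map⁺ (φᵇ-summand X) (∈-allFin x)) (∈φᵇ-summand⁺ X x x∈X (extensive _ (x∈⁅x⁆ x)))

  φᵇ⊆φ : φᵇ cl X ⊆ φ X
  φᵇ⊆φ {X} h with ∈φᵇ⁻ X h
  ... | y , y∈X , x∈φy = monotone (x∈p⇒⁅x⁆⊆p y∈X) x∈φy

  φᵇ⊆⇒φ⊆ : φᵇ cl A ⊆ φᵇ cl B → φ A ⊆ φ B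
  φᵇ⊆⇒φ⊆ {B = B} φᵇA⊆φᵇB = φ-least (φᵇ⊆φ ∘ φᵇA⊆φᵇB ∘ ⊆φᵇ) (idempotent B)

  DGenerator-below : ∀ B → x ∈ φ B → x ∉ φᵇ cl B →
                     ∃ λ A → φᵇ cl A ⊆ φᵇ cl B × DGenerator cl A x
  DGenerator-below {x} = All.wfRec (On.wellFounded (φᵇ cl) ⊂-wellFounded) _ Below descend
    where
      Below : Subset n → Set
      Below B = x ∈ φ B → x ∉ φᵇ cl B → ∃ λ A → φᵇ cl A ⊆ φᵇ cl B × DGenerator cl A x
      descend : ∀ B → WfRec (_⊂_ on φᵇ cl) Below B → Below B
      descend B smaller x∈φB x∉φᵇB with anySubset? (λ B' → φᵇ cl B' ⊂? φᵇ cl B ×-dec x ∈? φ B')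
      ... | yes (B' , B'⊂B , x∈φB') =
        let A , A⊆B' , gen = smaller B'⊂B x∈φB' (x∉φᵇB ∘ proj₁ B'⊂B)
        in A , ⊆-trans A⊆B' (proj₁ B'⊂B) , gen
      ... | no none = B , ⊆-refl , x∈φB , x∉φᵇB , λ B' B'⊂B x∈φB' → none (B' , B'⊂B , x∈φB')

  EGenerator-minimal : EGenerator cl A x → x ∈ φ B → x ∉ φᵇ cl B → ¬ (φ B ⊂ φ A)
  EGenerator-minimal (_ , minimal) x∈φB x∉φᵇB φB⊂φA with DGenerator-below _ x∈φB x∉φᵇB
  ... | A' , A'⊆B , gen = minimal A' gen (⊆-⊂-trans (φᵇ⊆⇒φ⊆ A'⊆B) φB⊂φA)

  InΣE-induction : (Pr : Fin n → Set) → (∀ {x} → x ∈ X → Pr x) →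
                   (∀ {A x} → EBase cl A x → (∀ {a} → a ∈ A → Pr a) → Pr x) →
                   ∀ {x} → InΣE cl X x → Pr x
  InΣE-induction Pr base-case step-case (base x∈X) = base-case x∈X
  InΣE-induction Pr base-case step-case (step e A⊆ΣE) =
    step-case e (λ a∈A → InΣE-induction Pr base-case step-case (A⊆ΣE _ a∈A))

  predecessor-closed : Predecessor cl Y C → Closed cl Y
  predecessor-closed = proj₁

  predecessor-⊂ : Predecessor cl Y C → Y ⊂ C
  predecessor-⊂ = proj₁ ∘ proj₂

  predecessor-⊆ : Predecessor cl Y C → Y ⊆ C
  predecessor-⊆ = proj₁ ∘ predecessor-⊂

  predecessor-covered : Predecessor cl Y C → Closed cl Z → Y ⊂ Z → Z ⊆ C → C ⊆ Z
  predecessor-covered (_ , _ , cover) cZ Y⊂Z Z⊆C c∈C =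
    ∈-stable (λ c∉Z → cover _ cZ Y⊂Z (Z⊆C , _ , c∈C , c∉Z))

  predecessor-≡ : Predecessor cl X C → Predecessor cl Y C → X ⊆ Y → X ≡ Y
  predecessor-≡ (_ , _ , cover) (cY , Y⊂C , _) X⊆Y =
    ⊆-antisym X⊆Y (λ w∈Y → ∈-stable (λ w∉X → cover _ cY (X⊆Y , _ , w∈Y , w∉X) Y⊂C))

  predecessor-above : ∀ E → Closed cl E → E ⊂ C → ∃ λ Y → Predecessor cl Y C × E ⊆ Y
  predecessor-above {C} = All.wfRec ⊃-wellFounded _ Above climb
    where
      Above : Subset n → Set
      Above E = Closed cl E → E ⊂ C → ∃ λ Y → Predecessor cl Y C × E ⊆ Y
      climb : ∀ E → WfRec _⊃_ Above E → Above E
      climb E larger cE E⊂C with anySubset? (λ F → Closed? F ×-dec E ⊂? F ×-dec F ⊂? C)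
      ... | yes (F , cF , E⊂F , F⊂C) =
        let Y , Y≺C , F⊆Y = larger E⊂F cF F⊂C in Y , Y≺C , ⊆-trans (proj₁ E⊂F) F⊆Y
      ... | no none = E , (cE , E⊂C , λ F cF E⊂F F⊂C → none (F , cF , E⊂F , F⊂C)) , ⊆-refl

  φ⁅x⁆-joinIrreducible : Standard cl → ∀ x → JoinIrreducible cl (φ ⁅ x ⁆)
  φ⁅x⁆-joinIrreducible std x = φx - x , φx-x≺φx , unique
    where
      φx : Subset n
      φx = φ ⁅ x ⁆
      φx⊆ : Closed cl F → x ∈ F → φx ⊆ F
      φx⊆ cF x∈F = φ-least (x∈p⇒⁅x⁆⊆p x∈F) cF
      φx-x≺φx : Predecessor cl (φx - x) φx
      φx-x≺φx = std x , (p─q⊆p φx ⁅ x ⁆ , x , extensive _ (x∈⁅x⁆ x) , λ h → x∈p─q⇒x∉q h (x∈⁅x⁆ x)) ,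
        λ F cF (_ , w , w∈F , w∉φx-x) (F⊆φx , c , c∈φx , c∉F) →
          let w≡x = decidable-stable (w ≟ x) (w∉φx-x ∘ x∈p∧x≢y⇒x∈p-y (F⊆φx w∈F))
          in c∉F (φx⊆ cF (subst (_∈ F) w≡x w∈F) c∈φx)
      unique : ∀ Y → Predecessor cl Y φx → Y ≡ φx - x
      unique Y Y≺φx@(cY , (Y⊆φx , c , c∈φx , c∉Y) , _) = predecessor-≡ Y≺φx φx-x≺φx Y⊆φx-x
        where
          Y⊆φx-x : Y ⊆ φx - x
          Y⊆φx-x y∈Y = x∈p∧x≢y⇒x∈p-y (Y⊆φx y∈Y) (λ y≡x → c∉Y (φx⊆ cY (subst (_∈ Y) y≡x y∈Y) c∈φx))

  predecessor-containing : Standard cl → Closed cl C → ¬ JoinIrreducible cl C →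
                           x ∈ C → ∃ λ Y → Predecessor cl Y C × x ∈ Y
  predecessor-containing {C} {x} std cC ¬ji x∈C =
    let c , c∈C , c∉φx = ⊈⇒∃∉ C⊈φx
        Y , Y≺C , φx⊆Y = predecessor-above _ (idempotent _) (φx⊆C , c , c∈C , c∉φx)
    in Y , Y≺C , φx⊆Y (extensive _ (x∈⁅x⁆ x))
    where
      φx⊆C : φ ⁅ x ⁆ ⊆ C
      φx⊆C = φ-least (x∈p⇒⁅x⁆⊆p x∈C) cC
      C⊈φx : C ⊈ φ ⁅ x ⁆
      C⊈φx C⊆φx = ¬ji (subst (JoinIrreducible cl) (⊆-antisym φx⊆C C⊆φx) (φ⁅x⁆-joinIrreducible std x))

module ModularProperties {n : ℕ} (cl : ClosureOperator n) (modular : Modular cl)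
                         {C : Subset n} (C-closed : Closed cl C) where
  open ClosureOperator cl
  open ClosureProperties cl

  private variable
    F G Q X Y Z : Subset n
    a w x : Fin n

  -- F ⊈ Y makes F ∨ Y = C, so X = X ∧ (F ∨ Y) = F ∨ (X ∧ Y) = F by the modular law.
  absorbs-meet-with-predecessor : Predecessor cl Y C → Closed cl X → X ⊆ C → Closed cl F → F ⊆ X →
                                  X ∩ Y ⊆ F → w ∈ F → w ∉ Y → X ⊆ F
  absorbs-meet-with-predecessor {Y} {X} {F} Y≺C cX X⊆C cF F⊆X X∩Y⊆F w∈F w∉Y x∈X =
    φ-least (∪-least ⊆-refl Y∩X⊆F) cF
      (subst (_ ∈_) (sym (modular F Y X cF (predecessor-closed Y≺C) cX F⊆X)) (x∈p∩q⁺ (C⊆F∨Y (X⊆C x∈X) , x∈X)))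
    where
      Y∩X⊆F : Y ∩ X ⊆ F
      Y∩X⊆F = X∩Y⊆F ∘ subst (_ ∈_) (∩-comm Y X)
      C⊆F∨Y : C ⊆ φ (F ∪ Y)
      C⊆F∨Y = predecessor-covered Y≺C (idempotent _)
        (extensive _ ∘ q⊆p∪q F Y , _ , extensive _ (p⊆p∪q Y w∈F) , w∉Y)
        (φ-least (∪-least (X⊆C ∘ F⊆X) (predecessor-⊆ Y≺C)) C-closed)

  -- The closure of (G ∩ Y) ∪ (G ∩ Z) stays inside Q by quasi-closedness, yet contains all of G
  -- as soon as it leaves Y.
  escapes-quasiClosed⇒∩⊆ : QuasiClosed cl Q → φ Q ≡ C → Predecessor cl Y C → Y ⊆ Q → Z ⊆ Q →
                            Closed cl G → G ⊂ C → x ∈ G → x ∉ Q → G ∩ Z ⊆ Y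
  escapes-quasiClosed⇒∩⊆ {Q} {Y} {Z} {G} quasi φQ≡C Y≺C Y⊆Q Z⊆Q cG (G⊆C , c , c∈C , c∉G) x∈G x∉Q t∈G∩Z =
    ∈-stable λ t∉Y → x∉Q (φM⊆Q (G⊆φM t∉Y x∈G))
    where
      M : Subset n
      M = (G ∩ Y) ∪ (G ∩ Z)
      φM⊆G : φ M ⊆ G
      φM⊆G = φ-least (∪-least (p∩q⊆p G Y) (p∩q⊆p G Z)) cG
      φM⊆Q : φ M ⊆ Q
      φM⊆Q = quasi M (∪-least (Y⊆Q ∘ p∩q⊆q G Y) (Z⊆Q ∘ p∩q⊆q G Z))
        (subst (φ M ⊆_) (sym φQ≡C) (G⊆C ∘ φM⊆G) , c , subst (c ∈_) (sym φQ≡C) c∈C , c∉G ∘ φM⊆G)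
      G⊆φM : _ ∉ Y → G ⊆ φ M
      G⊆φM t∉Y = absorbs-meet-with-predecessor Y≺C cG G⊆C (idempotent M) φM⊆G
        (extensive M ∘ p⊆p∪q (G ∩ Z)) (extensive M (q⊆p∪q (G ∩ Y) (G ∩ Z) t∈G∩Z)) t∉Y

  φ⁅a⁆-a⊆predecessor : Standard cl → Predecessor cl Y C → a ∈ C → φ ⁅ a ⁆ - a ⊆ Y
  φ⁅a⁆-a⊆predecessor {Y} {a} std Y≺C a∈C with a ∈? Y
  ... | yes a∈Y = φ-least (x∈p⇒⁅x⁆⊆p a∈Y) (predecessor-closed Y≺C) ∘ p─q⊆p _ ⁅ a ⁆
  ... | no a∉Y  = λ y∈φa-a → ∈-stable λ y∉Y →
    x∈p─q⇒x∉q (φa⊆φa-a y∈φa-a y∉Y (extensive _ (x∈⁅x⁆ a))) (x∈⁅x⁆ a)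
    where
      φa : Subset n
      φa = φ ⁅ a ⁆
      φa∩Y⊆φa-a : φa ∩ Y ⊆ φa - a
      φa∩Y⊆φa-a t∈φa∩Y = let t∈φa , t∈Y = x∈p∩q⁻ φa Y t∈φa∩Y in
        x∈p∧x≢y⇒x∈p-y t∈φa (λ t≡a → a∉Y (subst (_∈ Y) t≡a t∈Y))
      φa⊆φa-a : w ∈ φa - a → w ∉ Y → φa ⊆ φa - a
      φa⊆φa-a = absorbs-meet-with-predecessor Y≺C (idempotent _) (φ-least (x∈p⇒⁅x⁆⊆p a∈C) C-closed)
        (std a) (p─q⊆p φa ⁅ a ⁆) φa∩Y⊆φa-a

  predecessor-∩-⊆ : Predecessor cl X C → Predecessor cl Y C → Predecessor cl Z C → Z ≢ X →
                    X ∩ Y ⊆ Z → Z ∩ X ⊆ Y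
  predecessor-∩-⊆ {X} {Y} {Z} X≺C Y≺C Z≺C Z≢X X∩Y⊆Z t∈Z∩X = ∈-stable λ t∉Y →
    Z≢X (sym (predecessor-≡ X≺C Z≺C (p∩q⊆p Z X ∘ X⊆Z∩X t∉Y)))
    where
      X∩Y⊆Z∩X : X ∩ Y ⊆ Z ∩ X
      X∩Y⊆Z∩X h = x∈p∩q⁺ (X∩Y⊆Z h , p∩q⊆p X Y h)
      X⊆Z∩X : _ ∉ Y → X ⊆ Z ∩ X
      X⊆Z∩X = absorbs-meet-with-predecessor Y≺C (predecessor-closed X≺C) (predecessor-⊆ X≺C)
        (Closed-∩ (predecessor-closed Z≺C) (predecessor-closed X≺C)) (p∩q⊆q Z X) X∩Y⊆Z∩X t∈Z∩X

module PairOfPredecessors {n : ℕ} (cl : ClosureOperator n) (std : Standard cl) (modular : Modular cl)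
  {C : Subset n} (¬ji : ¬ JoinIrreducible cl C)
  {Ci Cj : Subset n} (Ci≺C : Predecessor cl Ci C) (Cj≺C : Predecessor cl Cj C)
  (P-pseudoClosed : PseudoClosed cl (Ci ∪ Cj)) (φP≡C : ClosureOperator.φ cl (Ci ∪ Cj) ≡ C) where
  open ClosureOperator cl
  open ClosureProperties cl

  private variable
    A G Y : Subset n
    x y : Fin n

  P D : Subset n
  P = Ci ∪ Cj
  D = Ci ∩ Cj

  C-closed : Closed cl C
  C-closed = trans (cong φ (sym φP≡C)) (trans (idempotent P) φP≡C)

  open ModularProperties cl modular C-closed

  Ci⊆P : Ci ⊆ P
  Ci⊆P = p⊆p∪q Cj

  Cj⊆P : Cj ⊆ P
  Cj⊆P = q⊆p∪q Ci Cj

  D⊆P : D ⊆ P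
  D⊆P = Ci⊆P ∘ p∩q⊆p Ci Cj

  P⊆C : P ⊆ C
  P⊆C = subst (_ ∈_) φP≡C ∘ extensive P

  D-closed : Closed cl D
  D-closed = Closed-∩ (predecessor-closed Ci≺C) (predecessor-closed Cj≺C)

  Ci⊈Cj : Ci ⊈ Cj
  Ci⊈Cj Ci⊆Cj = proj₁ P-pseudoClosed
    (φ⊆⇒Closed (Cj⊆P ∘ φ-least (∪-least Ci⊆Cj ⊆-refl) (predecessor-closed Cj≺C)))

  ∃∈C∖P : ∃ λ x → x ∈ C × x ∉ P
  ∃∈C∖P = ⊈⇒∃∉ λ C⊆P → proj₁ P-pseudoClosed (φ⊆⇒Closed (C⊆P ∘ subst (_ ∈_) φP≡C))

  escapes-P⇒∩P⊆D : Closed cl G → G ⊂ C → x ∈ G → x ∉ P → G ∩ P ⊆ D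
  escapes-P⇒∩P⊆D {G} cG G⊂C x∈G x∉P t∈G∩P =
    let t∈G , t∈P = x∈p∩q⁻ G P t∈G∩P in
    [ (λ t∈Ci → x∈p∩q⁺ (t∈Ci , escapes Cj≺C Cj⊆P Ci⊆P (x∈p∩q⁺ (t∈G , t∈Ci))))
    , (λ t∈Cj → x∈p∩q⁺ (escapes Ci≺C Ci⊆P Cj⊆P (x∈p∩q⁺ (t∈G , t∈Cj)) , t∈Cj))
    ]′ (x∈p∪q⁻ Ci Cj t∈P)
    where
      escapes : ∀ {Y Z} → Predecessor cl Y C → Y ⊆ P → Z ⊆ P → G ∩ Z ⊆ Y
      escapes Y≺C Y⊆P Z⊆P = escapes-quasiClosed⇒∩⊆ (proj₁ (proj₂ P-pseudoClosed)) φP≡C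
        Y≺C Y⊆P Z⊆P cG G⊂C x∈G x∉P

  D⊆escaping-predecessor : Predecessor cl Y C → x ∈ Y → x ∉ P → D ⊆ Y
  D⊆escaping-predecessor {Y} Y≺C x∈Y x∉P d∈D = ∈-stable λ d∉Y →
    Ci⊈Cj (p∩q⊆q Ci Cj ∘ absorbs-meet-with-predecessor Y≺C (predecessor-closed Ci≺C) (predecessor-⊆ Ci≺C)
      D-closed (p∩q⊆p Ci Cj) Ci∩Y⊆D d∈D d∉Y)
    where
      Ci∩Y⊆D : Ci ∩ Y ⊆ D
      Ci∩Y⊆D h = let t∈Ci , t∈Y = x∈p∩q⁻ Ci Y h in
        escapes-P⇒∩P⊆D (predecessor-closed Y≺C) (predecessor-⊂ Y≺C) x∈Y x∉P (x∈p∩q⁺ (t∈Y , Ci⊆P t∈Ci))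

  -- A predecessor Y ⊆ P meets a predecessor Cm through a point of C ∖ P only inside D,
  -- so if D ⊈ Y the modular law would put Cm, and with it that point, into D ⊆ P.
  D⊆predecessor : Predecessor cl Y C → D ⊆ Y
  D⊆predecessor {Y} Y≺C with Y ⊆? P
  ... | no Y⊈P = let y , y∈Y , y∉P = ⊈⇒∃∉ Y⊈P in D⊆escaping-predecessor Y≺C y∈Y y∉P
  ... | yes Y⊆P with ∃∈C∖P
  ...   | x , x∈C , x∉P with predecessor-containing std C-closed ¬ji x∈C
  ...     | Cm , Cm≺C , x∈Cm = λ d∈D → ∈-stable λ d∉Y → x∉P (D⊆P (Cm⊆D d∈D d∉Y x∈Cm))
    where
      Cm∩Y⊆D : Cm ∩ Y ⊆ D
      Cm∩Y⊆D h = let t∈Cm , t∈Y = x∈p∩q⁻ Cm Y h in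
        escapes-P⇒∩P⊆D (predecessor-closed Cm≺C) (predecessor-⊂ Cm≺C) x∈Cm x∉P (x∈p∩q⁺ (t∈Cm , Y⊆P t∈Y))
      Cm⊆D : _ ∈ D → _ ∉ Y → Cm ⊆ D
      Cm⊆D = absorbs-meet-with-predecessor Y≺C (predecessor-closed Cm≺C) (predecessor-⊆ Cm≺C) D-closed
        (D⊆escaping-predecessor Cm≺C x∈Cm x∉P) Cm∩Y⊆D

  ⋂≡D : ∀ preds → (∀ Y → (Y ∈ₗ preds) ⇔ Predecessor cl Y C) → ⋂ cl preds ≡ D
  ⋂≡D preds listed = ⊆-antisym
    (λ h → x∈p∩q⁺ (∈⋂⁻ h (Equivalence.from (listed Ci) Ci≺C) , ∈⋂⁻ h (Equivalence.from (listed Cj) Cj≺C)))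
    (λ d∈D → ∈⋂⁺ (λ {Y} Y∈preds → D⊆predecessor (Equivalence.to (listed Y) Y∈preds) d∈D))

  OtherPredecessorBeyond : Subset n → Set
  OtherPredecessorBeyond S = ∃[ Ck ] (Predecessor cl Ck C × Ck ≢ Ci × Ck ≢ Cj × 1 < ∣ Ck ─ S ∣)

  OtherPredecessorBeyond? : ∀ preds → (∀ Y → (Y ∈ₗ preds) ⇔ Predecessor cl Y C) →
                            ∀ S → Dec (OtherPredecessorBeyond S)
  OtherPredecessorBeyond? preds listed S = ∃-listed? preds listed λ Ck →
    ¬? (≡-dec Bool._≟_ Ck Ci) ×-dec ¬? (≡-dec Bool._≟_ Ck Cj) ×-dec 1 <? ∣ Ck ─ S ∣

  module OtherPredecessor {Ck : Subset n} (Ck≺C : Predecessor cl Ck C) (Ck≢Ci : Ck ≢ Ci) (Ck≢Cj : Ck ≢ Cj)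
    where

    Ck-closed : Closed cl Ck
    Ck-closed = predecessor-closed Ck≺C

    D⊆Ck : D ⊆ Ck
    D⊆Ck = D⊆predecessor Ck≺C

    Ck∩Ci⊆Cj : Ck ∩ Ci ⊆ Cj
    Ck∩Ci⊆Cj = predecessor-∩-⊆ Ci≺C Cj≺C Ck≺C Ck≢Ci D⊆Ck

    Ck∩Cj⊆Ci : Ck ∩ Cj ⊆ Ci
    Ck∩Cj⊆Ci = predecessor-∩-⊆ Cj≺C Ci≺C Ck≺C Ck≢Cj (D⊆Ck ∘ subst (_ ∈_) (∩-comm Cj Ci))

    Ck∩P⊆D : Ck ∩ P ⊆ D
    Ck∩P⊆D h = let t∈Ck , t∈P = x∈p∩q⁻ Ck P h in
      [ (λ t∈Ci → x∈p∩q⁺ (t∈Ci , Ck∩Ci⊆Cj (x∈p∩q⁺ (t∈Ck , t∈Ci))))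
      , (λ t∈Cj → x∈p∩q⁺ (Ck∩Cj⊆Ci (x∈p∩q⁺ (t∈Ck , t∈Cj)) , t∈Cj))
      ]′ (x∈p∪q⁻ Ci Cj t∈P)

    Ck─D-disjoint-P : x ∈ Ck ─ D → x ∉ P
    Ck─D-disjoint-P x∈Ck─D x∈P = x∈p─q⇒x∉q x∈Ck─D (Ck∩P⊆D (x∈p∩q⁺ (p─q⊆p Ck D x∈Ck─D , x∈P)))

    Ck⊆φ[D∪y] : y ∈ Ck → y ∉ P → Ck ⊆ φ (D ∪ ⁅ y ⁆)
    Ck⊆φ[D∪y] {y} y∈Ck y∉P = absorbs-meet-with-predecessor Ci≺C Ck-closed (predecessor-⊆ Ck≺C)
      (idempotent _) (φ-least (∪-least D⊆Ck (x∈p⇒⁅x⁆⊆p y∈Ck)) Ck-closed)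
      (λ h → extensive _ (p⊆p∪q ⁅ y ⁆ (x∈p∩q⁺ (p∩q⊆q Ck Ci h , Ck∩Ci⊆Cj h))))
      (extensive _ (q⊆p∪q D ⁅ y ⁆ (x∈⁅x⁆ y))) (y∉P ∘ Ci⊆P)

    -- E = φ (D ∪ G) contains Ck, but by the modular law E ∩ Ci = φ (D ∪ (G ∩ Ci)) = D, so E ≠ C.
    through-Ck∖P⇒⊆Ck : Closed cl G → G ⊂ C → y ∈ G → y ∈ Ck → y ∉ P → G ⊆ Ck
    through-Ck∖P⇒⊆Ck {G} cG G⊂C@(G⊆C , _) y∈G y∈Ck y∉P t∈G = ∈-stable λ t∉Ck →
      C⊈E (predecessor-covered Ck≺C (idempotent _) (Ck⊆E , _ , G⊆E t∈G , t∉Ck)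
        (φ-least (∪-least (P⊆C ∘ D⊆P) G⊆C) C-closed))
      where
        E : Subset n
        E = φ (D ∪ G)
        G⊆E : G ⊆ E
        G⊆E = extensive _ ∘ q⊆p∪q D G
        Ck⊆E : Ck ⊆ E
        Ck⊆E = monotone (∪-least (p⊆p∪q G) (q⊆p∪q D G ∘ x∈p⇒⁅x⁆⊆p y∈G)) ∘ Ck⊆φ[D∪y] y∈Ck y∉P
        G∩Ci⊆D : G ∩ Ci ⊆ D
        G∩Ci⊆D h = let t∈G , t∈Ci = x∈p∩q⁻ G Ci h in
          escapes-P⇒∩P⊆D cG G⊂C y∈G y∉P (x∈p∩q⁺ (t∈G , Ci⊆P t∈Ci))
        E∩Ci⊆D : E ∩ Ci ⊆ D
        E∩Ci⊆D = φ-least (∪-least ⊆-refl G∩Ci⊆D) D-closed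
          ∘ subst (_ ∈_) (sym (modular D G Ci D-closed cG (predecessor-closed Ci≺C) (p∩q⊆p Ci Cj)))
        C⊈E : C ⊈ E
        C⊈E C⊆E = Ci⊈Cj λ t∈Ci → p∩q⊆q Ci Cj (E∩Ci⊆D (x∈p∩q⁺ (C⊆E (predecessor-⊆ Ci≺C t∈Ci) , t∈Ci)))

    -- Otherwise D ∪ {x} would generate y with the smaller closure Ck.
    EGenerator-⊉C : EGenerator cl A y → y ∈ Ck → y ∉ P → x ∈ Ck → x ∉ P → x ≢ y → C ⊈ φ A
    EGenerator-⊉C {y = y} {x} eg y∈Ck y∉P x∈Ck x∉P x≢y C⊆φA =
      EGenerator-minimal eg (Ck⊆φ[D∪y] x∈Ck x∉P y∈Ck) y∉φᵇB
        (⊂-⊆-trans (⊆-⊂-trans φB⊆Ck (predecessor-⊂ Ck≺C)) C⊆φA)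
      where
        B : Subset n
        B = D ∪ ⁅ x ⁆
        φB⊆Ck : φ B ⊆ Ck
        φB⊆Ck = φ-least (∪-least D⊆Ck (x∈p⇒⁅x⁆⊆p x∈Ck)) Ck-closed
        y∉φᵇB : y ∉ φᵇ cl B
        y∉φᵇB h with ∈φᵇ⁻ B h
        ... | b , b∈B , y∈φb with x∈p∪q⁻ D ⁅ x ⁆ b∈B
        ...   | inj₁ b∈D = y∉P (D⊆P (φ-least (x∈p⇒⁅x⁆⊆p b∈D) D-closed y∈φb))
        ...   | inj₂ b∈⁅x⁆ rewrite x∈⁅y⁆⇒x≡y x b∈⁅x⁆ =
          y∉P (Ci⊆P (φ⁅a⁆-a⊆predecessor std Ci≺C (predecessor-⊆ Ck≺C x∈Ck) (x∈p∧x≢y⇒x∈p-y y∈φb (x≢y ∘ sym))))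

    EGenerator-step : 1 < ∣ Ck ─ D ∣ → EGenerator cl A y → A ⊆ C → (∀ {a} → a ∈ A → a ∈ Ck → a ∈ P) →
                      y ∈ Ck → y ∈ P
    EGenerator-step {A} {y} two eg A⊆C A∩Ck⊆P y∈Ck = ∈-stable λ y∉P →
      let x , x∈Ck─D , x≢y = 1<∣p∣⇒∃≢ two y
          c , c∈C , c∉φA = ⊈⇒∃∉ (EGenerator-⊉C eg y∈Ck y∉P (p─q⊆p Ck D x∈Ck─D) (Ck─D-disjoint-P x∈Ck─D) x≢y)
          φA⊆Ck = through-Ck∖P⇒⊆Ck (idempotent A) (φ-least A⊆C C-closed , c , c∈C , c∉φA) y∈φA y∈Ck y∉P
          A⊆D : A ⊆ D
          A⊆D a∈A = let a∈Ck = φA⊆Ck (extensive A a∈A) in Ck∩P⊆D (x∈p∩q⁺ (a∈Ck , A∩Ck⊆P a∈A a∈Ck))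
      in y∉P (D⊆P (φ-least A⊆D D-closed y∈φA))
      where
        y∈φA : y ∈ φ A
        y∈φA = proj₁ (proj₁ eg)

    ΣE-invariant : 1 < ∣ Ck ─ D ∣ → InΣE cl P y → y ∈ C × (y ∈ Ck → y ∈ P)
    ΣE-invariant two = InΣE-induction Invariant (λ y∈P → P⊆C y∈P , const y∈P) preserved
      where
        Invariant : Fin n → Set
        Invariant y = y ∈ C × (y ∈ Ck → y ∈ P)
        preserved : EBase cl A y → (∀ {a} → a ∈ A → Invariant a) → Invariant y
        preserved (inj₁ (a , refl , y≢a , y∈φa)) inv =
          φ-least (x∈p⇒⁅x⁆⊆p a∈C) C-closed y∈φa ,
          const (Ci⊆P (φ⁅a⁆-a⊆predecessor std Ci≺C a∈C (x∈p∧x≢y⇒x∈p-y y∈φa y≢a)))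
          where
            a∈C : a ∈ C
            a∈C = proj₁ (inv (x∈⁅x⁆ a))
        preserved (inj₂ eg) inv =
          φ-least (proj₁ ∘ inv) C-closed (proj₁ (proj₁ eg)) ,
          EGenerator-step two eg (proj₁ ∘ inv) (proj₂ ∘ inv)

    faulty : 1 < ∣ Ck ─ D ∣ → Faulty cl P
    faulty two φP⊆ΣE with 1<∣p∣⇒Nonempty two
    ... | u , u∈Ck─D = Ck─D-disjoint-P u∈Ck─D (proj₂ (ΣE-invariant two (φP⊆ΣE u u∈φP)) u∈Ck)
      where
        u∈Ck : u ∈ Ck
        u∈Ck = p─q⊆p Ck D u∈Ck─D
        u∈φP : u ∈ φ P
        u∈φP = subst (u ∈_) (sym φP≡C) (predecessor-⊆ Ck≺C u∈Ck)

  faulty-if-other : OtherPredecessorBeyond D → Faulty cl P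
  faulty-if-other (Ck , Ck≺C , Ck≢Ci , Ck≢Cj , two) = OtherPredecessor.faulty Ck≺C Ck≢Ci Ck≢Cj two

  φᵇP⊆P : φᵇ cl P ⊆ P
  φᵇP⊆P h with ∈φᵇ⁻ P h
  ... | b , b∈P , x∈φb =
    [ (λ b∈Ci → Ci⊆P (φ-least (x∈p⇒⁅x⁆⊆p b∈Ci) (predecessor-closed Ci≺C) x∈φb))
    , (λ b∈Cj → Cj⊆P (φ-least (x∈p⇒⁅x⁆⊆p b∈Cj) (predecessor-closed Cj≺C) x∈φb))
    ]′ (x∈p∪q⁻ Ci Cj b∈P)

  EGenerator-if-no-other : ¬ OtherPredecessorBeyond D → DGenerator cl A x → φ A ⊆ C → x ∉ P →
                           EGenerator cl A x
  EGenerator-if-no-other {A} {x} none gen φA⊆C x∉P = gen , minimal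
    where
      minimal : ∀ A' → DGenerator cl A' x → ¬ (φ A' ⊂ φ A)
      minimal A' (x∈φA' , x∉φᵇA' , _) φA'⊂φA
        with predecessor-above (φ A') (idempotent A') (⊂-⊆-trans φA'⊂φA φA⊆C)
      ... | Cl , Cl≺C , φA'⊆Cl = x∉P (D⊆P (φ-least A'⊆D D-closed x∈φA'))
        where
          x∈Cl : x ∈ Cl
          x∈Cl = φA'⊆Cl x∈φA'
          A'⊆D : A' ⊆ D
          A'⊆D a∈A' = ∈-stable λ a∉D → none (Cl , Cl≺C ,
            (λ Cl≡Ci → x∉P (Ci⊆P (subst (x ∈_) Cl≡Ci x∈Cl))) ,
            (λ Cl≡Cj → x∉P (Cj⊆P (subst (x ∈_) Cl≡Cj x∈Cl))) ,
            x∈p∧y∈p∧x≢y⇒1<∣p∣ (x∈p∧x∉q⇒x∈p─q x∈Cl (x∉P ∘ D⊆P))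
              (x∈p∧x∉q⇒x∈p─q (φA'⊆Cl (extensive A' a∈A')) a∉D)
              (λ x≡a → x∉φᵇA' (⊆φᵇ (subst (_∈ A') (sym x≡a) a∈A'))))

  ΣE-complete : ¬ OtherPredecessorBeyond D → ∀ x → x ∈ φ P → InΣE cl P x
  ΣE-complete none x x∈φP with x ∈? P
  ... | yes x∈P = base x∈P
  ... | no x∉P with DGenerator-below P x∈φP (x∉P ∘ φᵇP⊆P)
  ...   | A , φᵇA⊆φᵇP , gen =
    step (inj₂ (EGenerator-if-no-other none gen φA⊆C x∉P)) (λ a a∈A → base (φᵇP⊆P (φᵇA⊆φᵇP (⊆φᵇ a∈A))))
    where
      φA⊆C : φ A ⊆ C
      φA⊆C = subst (φ A ⊆_) φP≡C (φᵇ⊆⇒φ⊆ φᵇA⊆φᵇP)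

lemma7 : ∀ {n : ℕ} (cl : ClosureOperator n) → Standard cl → Modular cl →
         ∀ (C : Subset n) → Essential cl C → ¬ JoinIrreducible cl C →
         ∀ (preds : List (Subset n)) → (∀ D → (D ∈ₗ preds) ⇔ Predecessor cl D C) →
         ∀ (Ci Cj : Subset n) → Predecessor cl Ci C → Predecessor cl Cj C →
         PseudoClosed cl (Ci ∪ Cj) → ClosureOperator.φ cl (Ci ∪ Cj) ≡ C →
         (Faulty cl (Ci ∪ Cj) ⇔
           (∃[ Ck ] (Predecessor cl Ck C × Ck ≢ Ci × Ck ≢ Cj ×
                     1 < ∣ Ck ─ ⋂ cl preds ∣)))
lemma7 cl std modular C _ ¬ji preds listed Ci Cj Ci≺C Cj≺C P-pseudoClosed φP≡C =
  subst (λ S → Faulty cl P ⇔ OtherPredecessorBeyond S) (sym (⋂≡D preds listed)) (mk⇔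
    (λ isFaulty → decidable-stable (OtherPredecessorBeyond? preds listed D) (isFaulty ∘ ΣE-complete))
    faulty-if-other)
  where open PairOfPredecessors cl std modular ¬ji Ci≺C Cj≺C P-pseudoClosed φP≡C
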